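{- Let $b_0,b_1,b_2,b_3\in\mathbb{Q}[t]$ with $b_3\ne0$, and let $x\in\mathbb{Q}((t^{ -1}))$ be a solution of $b_3x^3+b_2x^2+b_1x+b_0=0$. Then $x$ satisfies the Riccati differential equation $Dx'=A+Bx+Cx^2$, where $A,B,C,D\in\mathbb{Q}[t]$ are given by $$D=\det\begin{pmatrix} b_1&-3b_0&b_2b_0\\ 2b_2&-2b_1&b_2b_1-3b_3b_0\\ 3b_3&-b_2&b_2^2-2b_3b_1\end{pmatrix}=4b_3b_1^3+4b_2^3b_0+27b_3^2b_0^2-b_2^2b_1^2-18b_3b_2b_1b_0,$$ $$A=\frac{1}{b_3}\det\begin{pmatrix} b_0b_3'-b_3b_0'&-3b_0&b_2b_0\\ b_1b_3'-b_3b_1'&-2b_1&b_2b_1-3b_3b_0\\ b_2b_3'-b_3b_2'&-b_2&b_2^2-2b_3b_1\end{pmatrix},\qquad B=\frac{1}{b_3}\det\begin{pmatrix} b_1&b_0b_3'-b_3b_0'&b_2b_0\\ 2b_2&b_1b_3'-b_3b_1'&b_2b_1-3b_3b_0\\ 3b_3&b_2b_3'-b_3b_2'&b_2^2-2b_3b_1\end{pmatrix},$$ $$C=\det\begin{pmatrix} b_1&-3b_0&b_0b_3'-b_3b_0'\\ 2b_2&-2b_1&b_1b_3'-b_3b_1'\\ 3b_3&-b_2&b_2b_3'-b_3b_2'\end{pmatrix}.$$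
   Context: $\mathbb{Q}((t^{ -1}))$ is the field of formal Laurent series in $t^{ -1}$ with rational coefficients; $'$ denotes the derivative $d/dt$, applied termwise to Laurent series and to polynomials. -}

module Defs where

open import Data.Nat as ℕ using (ℕ; zero; suc; _∸_; _≤ᵇ_)
open import Data.Integer as ℤ using (ℤ; +_; -[1+_])
open import Data.Rational as ℚ using (ℚ; 0ℚ; _/_)
open import Data.List using (List; []; _∷_; length; map; foldr; upTo)
open import Data.Bool using (if_then_else_)
open import Relation.Binary.PropositionalEquality using (_≡_)

-- Polynomials in ℚ[t]: coefficient lists, index i = coefficient of t^i
-- (trailing zeros allowed).

Poly : Set
Poly = List ℚ

nth : Poly → ℕ → ℚ
nth []       _       = 0ℚ
nth (a ∷ p)  zero    = a
nth (a ∷ p)  (suc i) = nth p i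

_+ₚ_ : Poly → Poly → Poly
[]      +ₚ q       = q
(a ∷ p) +ₚ []      = a ∷ p
(a ∷ p) +ₚ (b ∷ q) = (a ℚ.+ b) ∷ (p +ₚ q)

-ₚ_ : Poly → Poly
-ₚ p = map ℚ.-_ p

_-ₚ_ : Poly → Poly → Poly
p -ₚ q = p +ₚ (-ₚ q)

_·ₚ_ : ℚ → Poly → Poly
c ·ₚ p = map (c ℚ.*_) p

_*ₚ_ : Poly → Poly → Poly
[]      *ₚ q = []
(a ∷ p) *ₚ q = (a ·ₚ q) +ₚ (0ℚ ∷ (p *ₚ q))

int : ℤ → ℚ
int z = z / 1

derivFrom : ℕ → Poly → Poly
derivFrom i []      = []
derivFrom i (a ∷ p) = (int (+ i) ℚ.* a) ∷ derivFrom (suc i) p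

derivₚ : Poly → Poly
derivₚ []      = []
derivₚ (a ∷ p) = derivFrom 1 p

det3 : Poly → Poly → Poly → Poly → Poly → Poly → Poly → Poly → Poly → Poly
det3 a b c d e f g h i =
  ((a *ₚ ((e *ₚ i) -ₚ (f *ₚ h))) -ₚ (b *ₚ ((d *ₚ i) -ₚ (f *ₚ g))))
    +ₚ (c *ₚ ((d *ₚ h) -ₚ (e *ₚ g)))

-- Formal Laurent series in t⁻¹ over ℚ:  x = Σ_{k ≥ 0} c k · t^(deg - k).

infixl 6 _⊕_
infixl 7 _⊗_
infix 4 _≈_

record Laurent : Set where
  constructor laurent
  field
    deg : ℤ
    c   : ℕ → ℚ
open Laurent public

coeff : Laurent → ℤ → ℚ
coeff x n with deg x ℤ.- n
... | + k      = c x k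
... | -[1+ _ ] = 0ℚ

_≈_ : Laurent → Laurent → Set
x ≈ y = ∀ n → coeff x n ≡ coeff y n

0L : Laurent
0L = laurent (+ 0) (λ _ → 0ℚ)

_⊕_ : Laurent → Laurent → Laurent
x ⊕ y = laurent d (λ k → coeff x (d ℤ.- + k) ℚ.+ coeff y (d ℤ.- + k))
  where d = deg x ℤ.⊔ deg y

sumℚ : List ℚ → ℚ
sumℚ = foldr ℚ._+_ 0ℚ

_⊗_ : Laurent → Laurent → Laurent
x ⊗ y = laurent (deg x ℤ.+ deg y)
  (λ k → sumℚ (map (λ i → c x i ℚ.* c y (k ∸ i)) (upTo (suc k))))

deriv : Laurent → Laurent
deriv x = laurent (deg x) f
  where
  f : ℕ → ℚ
  f zero    = 0ℚ
  f (suc k) = int (deg x ℤ.- + k) ℚ.* c x k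

ι : Poly → Laurent
ι p = laurent (+ length p)
  (λ k → if k ≤ᵇ length p then nth p (length p ∸ k) else 0ℚ)

wₚ : Poly → Poly → Poly
wₚ bi b3 = (bi *ₚ derivₚ b3) -ₚ (b3 *ₚ derivₚ bi)

k : ℤ → Poly → Poly
k z p = int z ·ₚ p

Dₚ : Poly → Poly → Poly → Poly → Poly
Dₚ b0 b1 b2 b3 =
  det3 b1         (k (ℤ.- + 3) b0) (b2 *ₚ b0)
       (k (+ 2) b2) (k (ℤ.- + 2) b1) ((b2 *ₚ b1) -ₚ k (+ 3) (b3 *ₚ b0))
       (k (+ 3) b3) (-ₚ b2)          ((b2 *ₚ b2) -ₚ k (+ 2) (b3 *ₚ b1))

-- b3 · A
b3Aₚ : Poly → Poly → Poly → Poly → Poly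
b3Aₚ b0 b1 b2 b3 =
  det3 (wₚ b0 b3) (k (ℤ.- + 3) b0) (b2 *ₚ b0)
       (wₚ b1 b3) (k (ℤ.- + 2) b1) ((b2 *ₚ b1) -ₚ k (+ 3) (b3 *ₚ b0))
       (wₚ b2 b3) (-ₚ b2)          ((b2 *ₚ b2) -ₚ k (+ 2) (b3 *ₚ b1))

-- b3 · B
b3Bₚ : Poly → Poly → Poly → Poly → Poly
b3Bₚ b0 b1 b2 b3 =
  det3 b1           (wₚ b0 b3) (b2 *ₚ b0)
       (k (+ 2) b2) (wₚ b1 b3) ((b2 *ₚ b1) -ₚ k (+ 3) (b3 *ₚ b0))
       (k (+ 3) b3) (wₚ b2 b3) ((b2 *ₚ b2) -ₚ k (+ 2) (b3 *ₚ b1))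

Cₚ : Poly → Poly → Poly → Poly → Poly
Cₚ b0 b1 b2 b3 =
  det3 b1           (k (ℤ.- + 3) b0) (wₚ b0 b3)
       (k (+ 2) b2) (k (ℤ.- + 2) b1) (wₚ b1 b3)
       (k (+ 3) b3) (-ₚ b2)          (wₚ b2 b3)

-- Differentiating P(x) = b₃x³ + b₂x² + b₁x + b₀ = 0 gives
--   P′ = b₃′x³ + b₂′x² + b₁′x + b₀′ + (3b₃x² + 2b₂x + b₁)·x′ = 0.
-- The determinants are set up so that, for explicit integer polynomials U and V in the bᵢ, bᵢ′,
-- x and x′,
--   D·x′ − (A + Bx + Cx²) = U·P(x) + V·P′
-- is an identity of commutative rings, checked by normalisation. So it suffices that ℚ((t⁻¹)) is
-- a commutative ring on which d/dt obeys the sum and product rules and into which ℚ[t] embeds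
-- compatibly with d/dt. Writing two series with a common nominal degree reduces the ring laws to
-- those of the Cauchy product of coefficient sequences, and the product rule to the Leibniz rule
-- for the Euler operator t·d/dt, which acts on coefficients diagonally.

module Submission where

open import Defs

open import Algebra.Bundles using (CommutativeRing; RawRing)
open import Algebra.Structures using (IsCommutativeRing)
import Algebra.Solver.Ring
open import Algebra.Solver.Ring.AlmostCommutativeRing
  using (AlmostCommutativeRing; fromCommutativeRing; _-Raw-AlmostCommutative⟶_; Induced-equivalence)
open import Data.Bool using (true; false; if_then_else_)
open import Data.Empty using (⊥-elim)
import Data.Fin as Fin
open import Data.Fin using (#_)
open import Data.Integer as ℤ using (ℤ; +_; -[1+_]; 0ℤ)
import Data.Integer.Properties as ℤP
open import Data.List using ([]; _∷_; length; map; applyUpTo)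
open import Data.Maybe using (just; nothing)
open import Data.Nat as ℕ using (ℕ; zero; suc; _∸_)
import Data.Nat.Properties as ℕP
open import Data.Product using (Σ; _×_; _,_)
open import Data.Rational as ℚ using (ℚ; 0ℚ; 1ℚ; _/_)
import Data.Rational.Properties as ℚP
open import Data.Rational.Literals using (fromℤ)
open import Data.Vec as Vec using (Vec; _∷_; [])
import Data.Vec.Properties as VecP
open import Function using (_∘_)
open import Relation.Binary using (IsEquivalence; Setoid)
open import Relation.Binary.Definitions using (WeaklyDecidable)
open import Relation.Binary.PropositionalEquality
import Relation.Binary.Reasoning.Setoid as SetoidReasoning
open import Relation.Nullary using (¬_; yes; no)
open import Relation.Nullary.Reflects using (ofʸ; ofⁿ)

int-fromℤ : ∀ z → int z ≡ fromℤ z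
int-fromℤ z = ℚP.↥p/↧p≡p (fromℤ z)

int-+ : ∀ a b → int (a ℤ.+ b) ≡ int a ℚ.+ int b
int-+ a b rewrite int-fromℤ a | int-fromℤ b =
  cong₂ (λ u v → (u ℤ.+ v) / 1) (sym (ℤP.*-identityʳ a)) (sym (ℤP.*-identityʳ b))

int-* : ∀ a b → int (a ℤ.* b) ≡ int a ℚ.* int b
int-* a b rewrite int-fromℤ a | int-fromℤ b = refl

int-neg : ∀ a → int (ℤ.- a) ≡ ℚ.- int a
int-neg a rewrite int-fromℤ a | int-fromℤ (ℤ.- a) = fromℤ-neg a
  where
  fromℤ-neg : ∀ a → fromℤ (ℤ.- a) ≡ ℚ.- fromℤ a
  fromℤ-neg (+ 0)     = refl
  fromℤ-neg (+ suc n) = refl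
  fromℤ-neg -[1+ n ]  = refl

fromℕ : ℕ → ℚ
fromℕ n = int (+ n)

fromℕ-suc : ∀ n → fromℕ (suc n) ≡ 1ℚ ℚ.+ fromℕ n
fromℕ-suc n = int-+ (+ 1) (+ n)

module CauchyProduct where

  open import Data.Rational.Solver using (module +-*-Solver)
  open +-*-Solver

  Seq : Set
  Seq = ℕ → ℚ

  sumTo : ℕ → Seq → ℚ
  sumTo zero    f = 0ℚ
  sumTo (suc n) f = f 0 ℚ.+ sumTo n (f ∘ suc)

  sumℚ-applyUpTo : ∀ (g : ℕ → ℚ) h n → sumℚ (map g (applyUpTo h n)) ≡ sumTo n (g ∘ h)
  sumℚ-applyUpTo g h zero    = refl
  sumℚ-applyUpTo g h (suc n) = cong (g (h 0) ℚ.+_) (sumℚ-applyUpTo g (h ∘ suc) n)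

  sumTo-cong : ∀ n {f g : Seq} → f ≗ g → sumTo n f ≡ sumTo n g
  sumTo-cong zero    f≗g = refl
  sumTo-cong (suc n) f≗g = cong₂ ℚ._+_ (f≗g 0) (sumTo-cong n (f≗g ∘ suc))

  infixl 6 _+ₛ_
  infixl 7 _⋆_ _·ₛ_

  _+ₛ_ : Seq → Seq → Seq
  (a +ₛ b) i = a i ℚ.+ b i

  _·ₛ_ : ℚ → Seq → Seq
  (s ·ₛ a) i = s ℚ.* a i

  _⋆_ : Seq → Seq → Seq
  (a ⋆ b) n = sumTo (suc n) (λ i → a i ℚ.* b (n ∸ i))

  ⋆-cong : ∀ {a a′ b b′} → a ≗ a′ → b ≗ b′ → a ⋆ b ≗ a′ ⋆ b′
  ⋆-cong a≗a′ b≗b′ n = sumTo-cong (suc n) (λ i → cong₂ ℚ._*_ (a≗a′ i) (b≗b′ (n ∸ i)))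

  ⋆-congˡ : ∀ {a a′} b → a ≗ a′ → a ⋆ b ≗ a′ ⋆ b
  ⋆-congˡ b a≗a′ = ⋆-cong {b = b} a≗a′ (λ _ → refl)

  ⋆-congʳ : ∀ a {b b′} → b ≗ b′ → a ⋆ b ≗ a ⋆ b′
  ⋆-congʳ a b≗b′ = ⋆-cong {a} (λ _ → refl) b≗b′

  ⋆-at-0 : ∀ a b → (a ⋆ b) 0 ≡ a 0 ℚ.* b 0
  ⋆-at-0 a b = ℚP.+-identityʳ _

  ⋆-distribˡ-+ : ∀ a b d → a ⋆ (b +ₛ d) ≗ a ⋆ b +ₛ a ⋆ d
  ⋆-distribˡ-+ a b d zero =
    solve 3 (λ a b d → a :* (b :+ d) :+ con 0ℚ := (a :* b :+ con 0ℚ) :+ (a :* d :+ con 0ℚ)) refl (a 0) (b 0) (d 0)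
  ⋆-distribˡ-+ a b d (suc n) =
    trans (cong (a 0 ℚ.* (b (suc n) ℚ.+ d (suc n)) ℚ.+_) (⋆-distribˡ-+ (a ∘ suc) b d n))
          (solve 5 (λ a b d u v → a :* (b :+ d) :+ (u :+ v) := (a :* b :+ u) :+ (a :* d :+ v)) refl
                 (a 0) (b (suc n)) (d (suc n)) ((a ∘ suc ⋆ b) n) ((a ∘ suc ⋆ d) n))

  ⋆-distribʳ-+ : ∀ a b d → (a +ₛ b) ⋆ d ≗ a ⋆ d +ₛ b ⋆ d
  ⋆-distribʳ-+ a b d zero =
    solve 3 (λ a b d → (a :+ b) :* d :+ con 0ℚ := (a :* d :+ con 0ℚ) :+ (b :* d :+ con 0ℚ)) refl (a 0) (b 0) (d 0)
  ⋆-distribʳ-+ a b d (suc n) =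
    trans (cong ((a 0 ℚ.+ b 0) ℚ.* d (suc n) ℚ.+_) (⋆-distribʳ-+ (a ∘ suc) (b ∘ suc) d n))
          (solve 5 (λ a b d u v → (a :+ b) :* d :+ (u :+ v) := (a :* d :+ u) :+ (b :* d :+ v)) refl
                 (a 0) (b 0) (d (suc n)) ((a ∘ suc ⋆ d) n) ((b ∘ suc ⋆ d) n))

  ⋆-scaleˡ : ∀ s a b → (s ·ₛ a) ⋆ b ≗ s ·ₛ (a ⋆ b)
  ⋆-scaleˡ s a b zero =
    solve 3 (λ s a b → s :* a :* b :+ con 0ℚ := s :* (a :* b :+ con 0ℚ)) refl s (a 0) (b 0)
  ⋆-scaleˡ s a b (suc n) =
    trans (cong (s ℚ.* a 0 ℚ.* b (suc n) ℚ.+_) (⋆-scaleˡ s (a ∘ suc) b n))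
          (solve 4 (λ s a b u → s :* a :* b :+ s :* u := s :* (a :* b :+ u)) refl s (a 0) (b (suc n)) ((a ∘ suc ⋆ b) n))

  ⋆-comm : ∀ a b → a ⋆ b ≗ b ⋆ a
  ⋆-comm a b zero = solve 2 (λ a b → a :* b :+ con 0ℚ := b :* a :+ con 0ℚ) refl (a 0) (b 0)
  ⋆-comm a b (suc zero) =
    solve 4 (λ a₀ a₁ b₀ b₁ → a₀ :* b₁ :+ (a₁ :* b₀ :+ con 0ℚ) := b₀ :* a₁ :+ (b₁ :* a₀ :+ con 0ℚ)) refl
          (a 0) (a 1) (b 0) (b 1)
  ⋆-comm a b (suc (suc n)) = begin
    a 0 ℚ.* b (2 ℕ.+ n) ℚ.+ (a ∘ suc ⋆ b) (suc n)
      ≡⟨ cong (a 0 ℚ.* b (2 ℕ.+ n) ℚ.+_) (⋆-comm (a ∘ suc) b (suc n)) ⟩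
    a 0 ℚ.* b (2 ℕ.+ n) ℚ.+ (b 0 ℚ.* a (2 ℕ.+ n) ℚ.+ (b ∘ suc ⋆ a ∘ suc) n)
      ≡⟨ cong (λ z → a 0 ℚ.* b (2 ℕ.+ n) ℚ.+ (b 0 ℚ.* a (2 ℕ.+ n) ℚ.+ z)) (⋆-comm (b ∘ suc) (a ∘ suc) n) ⟩
    a 0 ℚ.* b (2 ℕ.+ n) ℚ.+ (b 0 ℚ.* a (2 ℕ.+ n) ℚ.+ (a ∘ suc ⋆ b ∘ suc) n)
      ≡⟨ solve 3 (λ p q r → p :+ (q :+ r) := q :+ (p :+ r)) refl
               (a 0 ℚ.* b (2 ℕ.+ n)) (b 0 ℚ.* a (2 ℕ.+ n)) ((a ∘ suc ⋆ b ∘ suc) n) ⟩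
    b 0 ℚ.* a (2 ℕ.+ n) ℚ.+ (a 0 ℚ.* b (2 ℕ.+ n) ℚ.+ (a ∘ suc ⋆ b ∘ suc) n)
      ≡⟨ cong (b 0 ℚ.* a (2 ℕ.+ n) ℚ.+_) (⋆-comm (b ∘ suc) a (suc n)) ⟨
    b 0 ℚ.* a (2 ℕ.+ n) ℚ.+ (b ∘ suc ⋆ a) (suc n)
      ∎
    where open ≡-Reasoning

  ⋆-assoc : ∀ a b d → (a ⋆ b) ⋆ d ≗ a ⋆ (b ⋆ d)
  ⋆-assoc a b d zero =
    solve 3 (λ a b d → (a :* b :+ con 0ℚ) :* d :+ con 0ℚ := a :* (b :* d :+ con 0ℚ) :+ con 0ℚ) refl (a 0) (b 0) (d 0)
  ⋆-assoc a b d (suc n) = begin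
    (a ⋆ b) 0 ℚ.* d (suc n) ℚ.+ ((a 0 ·ₛ b ∘ suc +ₛ a ∘ suc ⋆ b) ⋆ d) n
      ≡⟨ cong₂ (λ u v → u ℚ.* d (suc n) ℚ.+ v) (⋆-at-0 a b) (⋆-distribʳ-+ (a 0 ·ₛ b ∘ suc) (a ∘ suc ⋆ b) d n) ⟩
    a 0 ℚ.* b 0 ℚ.* d (suc n) ℚ.+ (((a 0 ·ₛ b ∘ suc) ⋆ d) n ℚ.+ ((a ∘ suc ⋆ b) ⋆ d) n)
      ≡⟨ cong₂ (λ u v → a 0 ℚ.* b 0 ℚ.* d (suc n) ℚ.+ (u ℚ.+ v))
               (⋆-scaleˡ (a 0) (b ∘ suc) d n) (⋆-assoc (a ∘ suc) b d n) ⟩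
    a 0 ℚ.* b 0 ℚ.* d (suc n) ℚ.+ (a 0 ℚ.* (b ∘ suc ⋆ d) n ℚ.+ (a ∘ suc ⋆ (b ⋆ d)) n)
      ≡⟨ solve 5 (λ a b d u v → a :* b :* d :+ (a :* u :+ v) := a :* (b :* d :+ u) :+ v) refl
               (a 0) (b 0) (d (suc n)) ((b ∘ suc ⋆ d) n) ((a ∘ suc ⋆ (b ⋆ d)) n) ⟩
    a 0 ℚ.* (b 0 ℚ.* d (suc n) ℚ.+ (b ∘ suc ⋆ d) n) ℚ.+ (a ∘ suc ⋆ (b ⋆ d)) n
      ∎
    where open ≡-Reasoning

  δ : Seq
  δ zero    = 1ℚ
  δ (suc i) = 0ℚ

  ⋆-identityʳ : ∀ a → a ⋆ δ ≗ a
  ⋆-identityʳ a zero    = trans (⋆-at-0 a δ) (ℚP.*-identityʳ (a 0))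
  ⋆-identityʳ a (suc n) = trans (cong₂ ℚ._+_ (ℚP.*-zeroʳ (a 0)) (⋆-identityʳ (a ∘ suc) n)) (ℚP.+-identityˡ _)

  shift : Seq → Seq
  shift a zero    = 0ℚ
  shift a (suc i) = a i

  ⋆-shiftˡ : ∀ a b → shift a ⋆ b ≗ shift (a ⋆ b)
  ⋆-shiftˡ a b zero    = trans (⋆-at-0 (shift a) b) (ℚP.*-zeroˡ (b 0))
  ⋆-shiftˡ a b (suc n) = trans (cong (ℚ._+ (a ⋆ b) n) (ℚP.*-zeroˡ (b (suc n)))) (ℚP.+-identityˡ _)

  -- If a lists the coefficients of a series of degree α, then euler α a lists those of t·x′.
  euler : ℚ → Seq → Seq
  euler α a i = (α ℚ.- fromℕ i) ℚ.* a i

  euler-suc : ∀ α a → euler α a ∘ suc ≗ euler (α ℚ.- 1ℚ) (a ∘ suc)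
  euler-suc α a i = cong (ℚ._* a (suc i)) (trans (cong (λ m → α ℚ.- m) (fromℕ-suc i))
    (solve 2 (λ α n → α :- (con 1ℚ :+ n) := (α :- con 1ℚ) :- n) refl α (fromℕ i)))

  ⋆-euler : ∀ α β a b → euler α a ⋆ b +ₛ euler β b ⋆ a ≗ euler (α ℚ.+ β) (a ⋆ b)
  ⋆-euler α β a b zero =
    solve 4 (λ α β a b → ((α :- con 0ℚ) :* a :* b :+ con 0ℚ) :+ ((β :- con 0ℚ) :* b :* a :+ con 0ℚ)
                        := (α :+ β :- con 0ℚ) :* (a :* b :+ con 0ℚ)) refl α β (a 0) (b 0)
  ⋆-euler α β a b (suc n) = begin
    euler α a 0 ℚ.* b (suc n) ℚ.+ (euler α a ∘ suc ⋆ b) n ℚ.+ (euler β b ⋆ a) (suc n)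
      ≡⟨ cong₂ (λ u v → euler α a 0 ℚ.* b (suc n) ℚ.+ u ℚ.+ v)
               (⋆-congˡ b (euler-suc α a) n) (⋆-comm (euler β b) a (suc n)) ⟩
    euler α a 0 ℚ.* b (suc n) ℚ.+ (euler α′ a′ ⋆ b) n ℚ.+ (a 0 ℚ.* euler β b (suc n) ℚ.+ (a′ ⋆ euler β b) n)
      ≡⟨ cong (λ z → euler α a 0 ℚ.* b (suc n) ℚ.+ (euler α′ a′ ⋆ b) n ℚ.+ (a 0 ℚ.* euler β b (suc n) ℚ.+ z))
              (⋆-comm a′ (euler β b) n) ⟩
    euler α a 0 ℚ.* b (suc n) ℚ.+ (euler α′ a′ ⋆ b) n ℚ.+ (a 0 ℚ.* euler β b (suc n) ℚ.+ (euler β b ⋆ a′) n)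
      ≡⟨ solve 4 (λ p q r s → p :+ q :+ (r :+ s) := p :+ r :+ (q :+ s)) refl
               (euler α a 0 ℚ.* b (suc n)) ((euler α′ a′ ⋆ b) n) (a 0 ℚ.* euler β b (suc n)) ((euler β b ⋆ a′) n) ⟩
    euler α a 0 ℚ.* b (suc n) ℚ.+ a 0 ℚ.* euler β b (suc n) ℚ.+ ((euler α′ a′ ⋆ b) n ℚ.+ (euler β b ⋆ a′) n)
      ≡⟨ cong₂ (λ m u → euler α a 0 ℚ.* b (suc n) ℚ.+ a 0 ℚ.* ((β ℚ.- m) ℚ.* b (suc n)) ℚ.+ u)
               (fromℕ-suc n) (⋆-euler α′ β a′ b n) ⟩
    (α ℚ.- 0ℚ) ℚ.* a 0 ℚ.* b (suc n) ℚ.+ a 0 ℚ.* ((β ℚ.- (1ℚ ℚ.+ fromℕ n)) ℚ.* b (suc n))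
      ℚ.+ (α′ ℚ.+ β ℚ.- fromℕ n) ℚ.* (a′ ⋆ b) n
      ≡⟨ solve 6 (λ α β m a b u → (α :- con 0ℚ) :* a :* b :+ a :* ((β :- (con 1ℚ :+ m)) :* b)
                                   :+ ((α :- con 1ℚ) :+ β :- m) :* u
                                  := (α :+ β :- (con 1ℚ :+ m)) :* (a :* b :+ u))
               refl α β (fromℕ n) (a 0) (b (suc n)) ((a′ ⋆ b) n) ⟩
    (α ℚ.+ β ℚ.- (1ℚ ℚ.+ fromℕ n)) ℚ.* (a ⋆ b) (suc n)
      ≡⟨ cong (λ m → (α ℚ.+ β ℚ.- m) ℚ.* (a ⋆ b) (suc n)) (fromℕ-suc n) ⟨
    euler (α ℚ.+ β) (a ⋆ b) (suc n)
      ∎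
    where
    open ≡-Reasoning
    α′ : ℚ
    α′ = α ℚ.- 1ℚ
    a′ : Seq
    a′ = a ∘ suc

module LaurentArithmetic where

  open CauchyProduct
  open import Data.Integer.Solver using (module +-*-Solver)
  open +-*-Solver

  atℤ : Seq → ℤ → ℚ
  atℤ a (+ i)    = a i
  atℤ a -[1+ _ ] = 0ℚ

  atℤ-cong : ∀ {a b} → a ≗ b → atℤ a ≗ atℤ b
  atℤ-cong a≗b (+ i)    = a≗b i
  atℤ-cong a≗b -[1+ _ ] = refl

  atℤ-map : ∀ (f : ℚ → ℚ) {a b} → f 0ℚ ≡ 0ℚ → (∀ m → b m ≡ f (a m)) → ∀ j → atℤ b j ≡ f (atℤ a j)
  atℤ-map f f0≡0 b≗fa (+ m)    = b≗fa m
  atℤ-map f f0≡0 b≗fa -[1+ _ ] = sym f0≡0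

  atℤ-negative : ∀ a {j} → j ℤ.< 0ℤ → atℤ a j ≡ 0ℚ
  atℤ-negative a { -[1+ _ ]} _             = refl
  atℤ-negative a {+ _}      (ℤ.+<+ ())

  coeff-atℤ : ∀ x n → coeff x n ≡ atℤ (c x) (deg x ℤ.- n)
  coeff-atℤ x n with deg x ℤ.- n
  ... | + _      = refl
  ... | -[1+ _ ] = refl

  coeff-aboveDeg : ∀ x {D} n → deg x ℤ.≤ D → D ℤ.- n ℤ.< 0ℤ → coeff x n ≡ 0ℚ
  coeff-aboveDeg x n deg≤D D-n<0 =
    trans (coeff-atℤ x n) (atℤ-negative (c x) (ℤP.≤-<-trans (ℤP.+-monoˡ-≤ (ℤ.- n) deg≤D) D-n<0))

  m-[m-n]≡n : ∀ d n → d ℤ.- (d ℤ.- n) ≡ n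
  m-[m-n]≡n = solve 2 (λ d n → d :- (d :- n) := n) refl

  coeff-laurent : ∀ D (f : ℤ → ℚ) → (∀ n → D ℤ.- n ℤ.< 0ℤ → f n ≡ 0ℚ) →
                  coeff (laurent D (λ i → f (D ℤ.- + i))) ≗ f
  coeff-laurent D f f-vanishes n with D ℤ.- n in eq
  ... | + i      = cong f (trans (cong (λ m → D ℤ.- m) (sym eq)) (m-[m-n]≡n D n))
  ... | -[1+ _ ] = sym (f-vanishes n (subst (ℤ._< 0ℤ) (sym eq) ℤ.-<+))

  coeff-⊕ : ∀ x y n → coeff (x ⊕ y) n ≡ coeff x n ℚ.+ coeff y n
  coeff-⊕ x y = coeff-laurent (deg x ℤ.⊔ deg y) (λ n → coeff x n ℚ.+ coeff y n) λ n D-n<0 →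
    trans (cong₂ ℚ._+_ (coeff-aboveDeg x n (ℤP.i≤i⊔j (deg x) (deg y)) D-n<0)
                       (coeff-aboveDeg y n (ℤP.i≤j⊔i (deg x) (deg y)) D-n<0))
          (ℚP.+-identityˡ 0ℚ)

  c-⊗ : ∀ x y → c (x ⊗ y) ≗ c x ⋆ c y
  c-⊗ x y n = sumℚ-applyUpTo (λ i → c x i ℚ.* c y (n ∸ i)) (λ i → i) (suc n)

  -- x ≈ y unfolds to a Π-type from which Agda cannot recover x and y; the record makes them inferable.
  infix 4 _≋_
  record _≋_ (x y : Laurent) : Set where
    constructor ≈⇒≋
    field ≋⇒≈ : x ≈ y
  open _≋_ public

  ≋-refl : ∀ {x} → x ≋ x
  ≋-refl = ≈⇒≋ λ _ → refl

  ≋-sym : ∀ {x y} → x ≋ y → y ≋ x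
  ≋-sym x≋y = ≈⇒≋ λ n → sym (≋⇒≈ x≋y n)

  ≋-trans : ∀ {x y z} → x ≋ y → y ≋ z → x ≋ z
  ≋-trans x≋y y≋z = ≈⇒≋ λ n → trans (≋⇒≈ x≋y n) (≋⇒≈ y≋z n)

  ≋-reflexive : ∀ {x y} → x ≡ y → x ≋ y
  ≋-reflexive refl = ≋-refl

  ≋-isEquivalence : IsEquivalence _≋_
  ≋-isEquivalence = record { refl = ≋-refl ; sym = ≋-sym ; trans = ≋-trans }

  ≋-setoid : Setoid _ _
  ≋-setoid = record { isEquivalence = ≋-isEquivalence }

  ≋-intro : ∀ {x y} → deg x ≡ deg y → c x ≗ c y → x ≋ y
  ≋-intro {laurent d a} {laurent .d b} refl a≗b = ≈⇒≋ λ n →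
    trans (coeff-atℤ (laurent d a) n) (trans (atℤ-cong a≗b (d ℤ.- n)) (sym (coeff-atℤ (laurent d b) n)))

  c-atDeg : ∀ x i → coeff x (deg x ℤ.- + i) ≡ c x i
  c-atDeg x i = trans (coeff-atℤ x _) (cong (atℤ (c x)) (m-[m-n]≡n (deg x) (+ i)))

  c-≋ : ∀ {x y} → deg x ≡ deg y → x ≋ y → c x ≗ c y
  c-≋ {x} {y} refl x≋y i = trans (sym (c-atDeg x i)) (trans (≋⇒≈ x≋y _) (c-atDeg y i))

  -- Degrees are only upper bounds, so a series can always be rewritten with a larger nominal degree.
  raise : ℕ → Laurent → Laurent
  raise s x = laurent (deg x ℤ.+ + s) (λ i → coeff x (deg x ℤ.+ + s ℤ.- + i))

  raise-≋ : ∀ s x → raise s x ≋ x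
  raise-≋ s x = ≈⇒≋ (coeff-laurent (deg x ℤ.+ + s) (coeff x) λ n → coeff-aboveDeg x n (ℤP.i≤i+j (deg x) (+ s)))

  shiftBy : ℕ → Seq → Seq
  shiftBy s a i = atℤ a (+ i ℤ.- + s)

  c-raise : ∀ s x → c (raise s x) ≗ shiftBy s (c x)
  c-raise s x i = trans (coeff-atℤ x _) (cong (atℤ (c x))
    (solve 3 (λ d s i → d :- ((d :+ s) :- i) := i :- s) refl (deg x) (+ s) (+ i)))

  shiftBy-zero : ∀ a → shiftBy 0 a ≗ a
  shiftBy-zero a i = cong (atℤ a) (ℤP.+-identityʳ (+ i))

  shiftBy-suc : ∀ s a → shiftBy (suc s) a ≗ shift (shiftBy s a)
  shiftBy-suc s a zero    = refl
  shiftBy-suc s a (suc i) = cong (atℤ a)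
    (solve 2 (λ i s → (con (+ 1) :+ i) :- (con (+ 1) :+ s) := i :- s) refl (+ i) (+ s))

  ⋆-shiftByˡ : ∀ s a b → shiftBy s a ⋆ b ≗ shiftBy s (a ⋆ b)
  ⋆-shiftByˡ zero a b n = trans (⋆-congˡ b (shiftBy-zero a) n) (sym (shiftBy-zero (a ⋆ b) n))
  ⋆-shiftByˡ (suc s) a b n =
    trans (⋆-congˡ b (shiftBy-suc s a) n)
          (trans (⋆-shiftˡ (shiftBy s a) b n) (trans (shift-IH n) (sym (shiftBy-suc s (a ⋆ b) n))))
    where
    shift-IH : shift (shiftBy s a ⋆ b) ≗ shift (shiftBy s (a ⋆ b))
    shift-IH zero    = refl
    shift-IH (suc n) = ⋆-shiftByˡ s a b n

  raise-⊗ : ∀ s x y → raise s x ⊗ y ≋ raise s (x ⊗ y)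
  raise-⊗ s x y = ≋-intro
    (solve 3 (λ d s e → (d :+ s) :+ e := (d :+ e) :+ s) refl (deg x) (+ s) (deg y)) λ n → begin
      c (raise s x ⊗ y) n            ≡⟨ c-⊗ (raise s x) y n ⟩
      (c (raise s x) ⋆ c y) n        ≡⟨ ⋆-congˡ (c y) (c-raise s x) n ⟩
      (shiftBy s (c x) ⋆ c y) n      ≡⟨ ⋆-shiftByˡ s (c x) (c y) n ⟩
      shiftBy s (c x ⋆ c y) n        ≡⟨ atℤ-cong (c-⊗ x y) (+ n ℤ.- + s) ⟨
      shiftBy s (c (x ⊗ y)) n        ≡⟨ c-raise s (x ⊗ y) n ⟨
      c (raise s (x ⊗ y)) n          ∎
    where open ≡-Reasoning

  alignDegrees : ∀ d d′ → Σ ℕ λ s → Σ ℕ λ s′ → d ℤ.+ + s ≡ d′ ℤ.+ + s′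
  alignDegrees d d′ with d ℤ.- d′ in eq
  ... | + m      = 0 , m , trans (ℤP.+-identityʳ d)
                     (trans (solve 2 (λ d d′ → d := d′ :+ (d :- d′)) refl d d′) (cong (λ m → d′ ℤ.+ m) eq))
  ... | -[1+ m ] = suc m , 0 , trans (cong (λ m → d ℤ.+ m) (sym (cong ℤ.-_ eq)))
                     (trans (solve 2 (λ d d′ → d :+ (:- (d :- d′)) := d′) refl d d′) (sym (ℤP.+-identityʳ d′)))

  ⊗-congˡ : ∀ {x x′} y → x ≋ x′ → x ⊗ y ≋ x′ ⊗ y
  ⊗-congˡ {x} {x′} y x≋x′ with alignDegrees (deg x) (deg x′)
  ... | s , s′ , e = begin
    x ⊗ y              ≈⟨ raise-≋ s (x ⊗ y) ⟨
    raise s (x ⊗ y)    ≈⟨ raise-⊗ s x y ⟨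
    X ⊗ y              ≈⟨ ≋-intro (cong (ℤ._+ deg y) e) (λ n →
                            trans (c-⊗ X y n) (trans (⋆-congˡ (c y) (c-≋ e X≋X′) n) (sym (c-⊗ X′ y n)))) ⟩
    X′ ⊗ y             ≈⟨ raise-⊗ s′ x′ y ⟩
    raise s′ (x′ ⊗ y)  ≈⟨ raise-≋ s′ (x′ ⊗ y) ⟩
    x′ ⊗ y             ∎
    where
    open SetoidReasoning ≋-setoid
    X X′ : Laurent
    X  = raise s x
    X′ = raise s′ x′
    X≋X′ : X ≋ X′
    X≋X′ = ≋-trans (raise-≋ s x) (≋-trans x≋x′ (≋-sym (raise-≋ s′ x′)))

  ⊗-comm : ∀ x y → x ⊗ y ≋ y ⊗ x
  ⊗-comm x y = ≋-intro (ℤP.+-comm (deg x) (deg y)) λ n →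
    trans (c-⊗ x y n) (trans (⋆-comm (c x) (c y) n) (sym (c-⊗ y x n)))

  ⊗-congʳ : ∀ x {y y′} → y ≋ y′ → x ⊗ y ≋ x ⊗ y′
  ⊗-congʳ x {y} {y′} y≋y′ = ≋-trans (⊗-comm x y) (≋-trans (⊗-congˡ x y≋y′) (⊗-comm y′ x))

  ⊗-cong : ∀ {x x′ y y′} → x ≋ x′ → y ≋ y′ → x ⊗ y ≋ x′ ⊗ y′
  ⊗-cong {x′ = x′} {y = y} x≋x′ y≋y′ = ≋-trans (⊗-congˡ y x≋x′) (⊗-congʳ x′ y≋y′)

  ⊗-assoc : ∀ x y z → (x ⊗ y) ⊗ z ≋ x ⊗ (y ⊗ z)
  ⊗-assoc x y z = ≋-intro (ℤP.+-assoc (deg x) (deg y) (deg z)) λ n → begin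
    c ((x ⊗ y) ⊗ z) n           ≡⟨ c-⊗ (x ⊗ y) z n ⟩
    (c (x ⊗ y) ⋆ c z) n         ≡⟨ ⋆-congˡ (c z) (c-⊗ x y) n ⟩
    ((c x ⋆ c y) ⋆ c z) n       ≡⟨ ⋆-assoc (c x) (c y) (c z) n ⟩
    (c x ⋆ (c y ⋆ c z)) n       ≡⟨ ⋆-congʳ (c x) (c-⊗ y z) n ⟨
    (c x ⋆ c (y ⊗ z)) n         ≡⟨ c-⊗ x (y ⊗ z) n ⟨
    c (x ⊗ (y ⊗ z)) n           ∎
    where open ≡-Reasoning

  1L : Laurent
  1L = laurent (+ 0) δ

  ⊗-identityʳ : ∀ x → x ⊗ 1L ≋ x
  ⊗-identityʳ x = ≋-intro (ℤP.+-identityʳ (deg x)) λ n → trans (c-⊗ x 1L n) (⋆-identityʳ (c x) n)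

  ⊗-identityˡ : ∀ x → 1L ⊗ x ≋ x
  ⊗-identityˡ x = ≋-trans (⊗-comm 1L x) (⊗-identityʳ x)

  ⊖_ : Laurent → Laurent
  ⊖ x = laurent (deg x) (λ i → ℚ.- c x i)

  coeff-⊖ : ∀ x n → coeff (⊖ x) n ≡ ℚ.- coeff x n
  coeff-⊖ x n = trans (coeff-atℤ (⊖ x) n)
    (trans (atℤ-map ℚ.-_ refl (λ _ → refl) (deg x ℤ.- n)) (cong ℚ.-_ (sym (coeff-atℤ x n))))

  atℤ-zero : ∀ j → atℤ (λ _ → 0ℚ) j ≡ 0ℚ
  atℤ-zero (+ _)    = refl
  atℤ-zero -[1+ _ ] = refl

  coeff-0L : ∀ n → coeff 0L n ≡ 0ℚ
  coeff-0L n = trans (coeff-atℤ 0L n) (atℤ-zero (+ 0 ℤ.- n))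

  ⊕-cong : ∀ {x x′ y y′} → x ≋ x′ → y ≋ y′ → x ⊕ y ≋ x′ ⊕ y′
  ⊕-cong {x} {x′} {y} {y′} x≋x′ y≋y′ = ≈⇒≋ λ n →
    trans (coeff-⊕ x y n) (trans (cong₂ ℚ._+_ (≋⇒≈ x≋x′ n) (≋⇒≈ y≋y′ n)) (sym (coeff-⊕ x′ y′ n)))

  ⊕-assoc : ∀ x y z → (x ⊕ y) ⊕ z ≋ x ⊕ (y ⊕ z)
  ⊕-assoc x y z = ≈⇒≋ λ n → begin
    coeff ((x ⊕ y) ⊕ z) n                   ≡⟨ coeff-⊕ (x ⊕ y) z n ⟩
    coeff (x ⊕ y) n ℚ.+ coeff z n           ≡⟨ cong (ℚ._+ coeff z n) (coeff-⊕ x y n) ⟩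
    coeff x n ℚ.+ coeff y n ℚ.+ coeff z n   ≡⟨ ℚP.+-assoc (coeff x n) (coeff y n) (coeff z n) ⟩
    coeff x n ℚ.+ (coeff y n ℚ.+ coeff z n) ≡⟨ cong (coeff x n ℚ.+_) (coeff-⊕ y z n) ⟨
    coeff x n ℚ.+ coeff (y ⊕ z) n           ≡⟨ coeff-⊕ x (y ⊕ z) n ⟨
    coeff (x ⊕ (y ⊕ z)) n                   ∎
    where open ≡-Reasoning

  ⊕-comm : ∀ x y → x ⊕ y ≋ y ⊕ x
  ⊕-comm x y = ≈⇒≋ λ n →
    trans (coeff-⊕ x y n) (trans (ℚP.+-comm (coeff x n) (coeff y n)) (sym (coeff-⊕ y x n)))

  ⊕-identityˡ : ∀ x → 0L ⊕ x ≋ x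
  ⊕-identityˡ x = ≈⇒≋ λ n →
    trans (coeff-⊕ 0L x n) (trans (cong (ℚ._+ coeff x n) (coeff-0L n)) (ℚP.+-identityˡ (coeff x n)))

  ⊕-identityʳ : ∀ x → x ⊕ 0L ≋ x
  ⊕-identityʳ x = ≋-trans (⊕-comm x 0L) (⊕-identityˡ x)

  ⊕-inverseʳ : ∀ x → x ⊕ ⊖ x ≋ 0L
  ⊕-inverseʳ x = ≈⇒≋ λ n → trans (coeff-⊕ x (⊖ x) n)
    (trans (cong (coeff x n ℚ.+_) (coeff-⊖ x n)) (trans (ℚP.+-inverseʳ (coeff x n)) (sym (coeff-0L n))))

  ⊕-inverseˡ : ∀ x → ⊖ x ⊕ x ≋ 0L
  ⊕-inverseˡ x = ≋-trans (⊕-comm (⊖ x) x) (⊕-inverseʳ x)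

  ⊖-cong : ∀ {x y} → x ≋ y → ⊖ x ≋ ⊖ y
  ⊖-cong {x} {y} x≋y = ≈⇒≋ λ n → trans (coeff-⊖ x n) (trans (cong ℚ.-_ (≋⇒≈ x≋y n)) (sym (coeff-⊖ y n)))

  ⊕-sameDeg : ∀ x y → deg x ≡ deg y → x ⊕ y ≋ laurent (deg x) (c x +ₛ c y)
  ⊕-sameDeg x y refl = ≈⇒≋ λ n → begin
    coeff (x ⊕ y) n                                       ≡⟨ coeff-⊕ x y n ⟩
    coeff x n ℚ.+ coeff y n                               ≡⟨ cong₂ ℚ._+_ (coeff-atℤ x n) (coeff-atℤ y n) ⟩
    atℤ (c x) (deg x ℤ.- n) ℚ.+ atℤ (c y) (deg x ℤ.- n)   ≡⟨ atℤ-+ (deg x ℤ.- n) ⟩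
    atℤ (c x +ₛ c y) (deg x ℤ.- n)                        ≡⟨ coeff-atℤ (laurent (deg x) (c x +ₛ c y)) n ⟨
    coeff (laurent (deg x) (c x +ₛ c y)) n                ∎
    where
    open ≡-Reasoning
    atℤ-+ : ∀ j → atℤ (c x) j ℚ.+ atℤ (c y) j ≡ atℤ (c x +ₛ c y) j
    atℤ-+ (+ _)    = refl
    atℤ-+ -[1+ _ ] = ℚP.+-identityˡ 0ℚ

  ⊗-distribˡ : ∀ x y z → x ⊗ (y ⊕ z) ≋ x ⊗ y ⊕ x ⊗ z
  ⊗-distribˡ x y z with alignDegrees (deg y) (deg z)
  ... | s , t , e = begin
    x ⊗ (y ⊕ z)                          ≈⟨ ⊗-congʳ x (⊕-cong (raise-≋ s y) (raise-≋ t z)) ⟨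
    x ⊗ (Y ⊕ Z)                          ≈⟨ ⊗-congʳ x (⊕-sameDeg Y Z e) ⟩
    x ⊗ laurent (deg Y) (c Y +ₛ c Z)     ≈⟨ ≋-intro refl (λ n →
                                              trans (c-⊗ x (laurent (deg Y) (c Y +ₛ c Z)) n)
                                              (trans (⋆-distribˡ-+ (c x) (c Y) (c Z) n)
                                              (sym (cong₂ ℚ._+_ (c-⊗ x Y n) (c-⊗ x Z n))))) ⟩
    laurent (deg x ℤ.+ deg Y) (c (x ⊗ Y) +ₛ c (x ⊗ Z))
                                         ≈⟨ ⊕-sameDeg (x ⊗ Y) (x ⊗ Z) (cong (λ d → deg x ℤ.+ d) e) ⟨
    x ⊗ Y ⊕ x ⊗ Z                        ≈⟨ ⊕-cong (⊗-congʳ x (raise-≋ s y)) (⊗-congʳ x (raise-≋ t z)) ⟩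
    x ⊗ y ⊕ x ⊗ z                        ∎
    where
    open SetoidReasoning ≋-setoid
    Y Z : Laurent
    Y = raise s y
    Z = raise t z

  ⊗-distribʳ : ∀ x y z → (y ⊕ z) ⊗ x ≋ y ⊗ x ⊕ z ⊗ x
  ⊗-distribʳ x y z = ≋-trans (⊗-comm (y ⊕ z) x) (≋-trans (⊗-distribˡ x y z) (⊕-cong (⊗-comm x y) (⊗-comm x z)))

module Derivation where

  open CauchyProduct
  open LaurentArithmetic
  open import Data.Integer.Solver using (module +-*-Solver)
  open +-*-Solver

  coeff-deriv : ∀ x n → coeff (deriv x) n ≡ int (n ℤ.+ + 1) ℚ.* coeff x (n ℤ.+ + 1)
  coeff-deriv x n = trans (coeff-atℤ (deriv x) n) (trans (byCase (d ℤ.- n) refl)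
    (cong (int (n ℤ.+ + 1) ℚ.*_) (sym (trans (coeff-atℤ x (n ℤ.+ + 1)) (cong (atℤ (c x)) index-pred)))))
    where
    d : ℤ
    d = deg x
    index-pred : d ℤ.- (n ℤ.+ + 1) ≡ (d ℤ.- n) ℤ.+ -[1+ 0 ]
    index-pred = solve 2 (λ d n → d :- (n :+ con (+ 1)) := (d :- n) :+ con -[1+ 0 ]) refl d n
    d-i≡n+1 : ∀ i → d ℤ.- n ≡ + suc i → d ℤ.- + i ≡ n ℤ.+ + 1
    d-i≡n+1 i e = begin
      d ℤ.- + i                     ≡⟨ solve 3 (λ d n i → d :- i := ((d :- n) :- i) :+ n) refl d n (+ i) ⟩
      ((d ℤ.- n) ℤ.- + i) ℤ.+ n     ≡⟨ cong (λ m → (m ℤ.- + i) ℤ.+ n) e ⟩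
      (+ suc i ℤ.- + i) ℤ.+ n       ≡⟨ solve 2 (λ i n → ((con (+ 1) :+ i) :- i) :+ n := n :+ con (+ 1)) refl (+ i) n ⟩
      n ℤ.+ + 1                     ∎
      where open ≡-Reasoning
    byCase : ∀ j → d ℤ.- n ≡ j → atℤ (c (deriv x)) j ≡ int (n ℤ.+ + 1) ℚ.* atℤ (c x) (j ℤ.+ -[1+ 0 ])
    byCase (+ zero)  _ = sym (ℚP.*-zeroʳ (int (n ℤ.+ + 1)))
    byCase (+ suc i) e = cong (λ m → int m ℚ.* c x i) (d-i≡n+1 i e)
    byCase -[1+ _ ]  _ = sym (ℚP.*-zeroʳ (int (n ℤ.+ + 1)))

  deriv-cong : ∀ {x y} → x ≋ y → deriv x ≋ deriv y
  deriv-cong {x} {y} x≋y = ≈⇒≋ λ n →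
    trans (coeff-deriv x n) (trans (cong (int (n ℤ.+ + 1) ℚ.*_) (≋⇒≈ x≋y _)) (sym (coeff-deriv y n)))

  deriv-⊕ : ∀ x y → deriv (x ⊕ y) ≋ deriv x ⊕ deriv y
  deriv-⊕ x y = ≈⇒≋ λ n → begin
    coeff (deriv (x ⊕ y)) n                          ≡⟨ coeff-deriv (x ⊕ y) n ⟩
    int (n ℤ.+ + 1) ℚ.* coeff (x ⊕ y) (n ℤ.+ + 1)    ≡⟨ cong (int (n ℤ.+ + 1) ℚ.*_) (coeff-⊕ x y _) ⟩
    int (n ℤ.+ + 1) ℚ.* (coeff x (n ℤ.+ + 1) ℚ.+ coeff y (n ℤ.+ + 1))
                                                     ≡⟨ ℚP.*-distribˡ-+ (int (n ℤ.+ + 1)) _ _ ⟩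
    int (n ℤ.+ + 1) ℚ.* coeff x (n ℤ.+ + 1) ℚ.+ int (n ℤ.+ + 1) ℚ.* coeff y (n ℤ.+ + 1)
                                                     ≡⟨ cong₂ ℚ._+_ (coeff-deriv x n) (coeff-deriv y n) ⟨
    coeff (deriv x) n ℚ.+ coeff (deriv y) n         ≡⟨ coeff-⊕ (deriv x) (deriv y) n ⟨
    coeff (deriv x ⊕ deriv y) n                      ∎
    where open ≡-Reasoning

  deriv-0L : deriv 0L ≋ 0L
  deriv-0L = ≈⇒≋ λ n → trans (coeff-deriv 0L n)
    (trans (cong (int (n ℤ.+ + 1) ℚ.*_) (coeff-0L (n ℤ.+ + 1)))
           (trans (ℚP.*-zeroʳ (int (n ℤ.+ + 1))) (sym (coeff-0L n))))

  -- deriv keeps the nominal degree, so the coefficients of x′ = t⁻¹·(t·x′) are those of t·x′ shifted by one.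
  c-deriv : ∀ x → c (deriv x) ≗ shift (euler (int (deg x)) (c x))
  c-deriv x zero    = refl
  c-deriv x (suc i) = cong (ℚ._* c x i) (trans (int-+ (deg x) (ℤ.- + i)) (cong (int (deg x) ℚ.+_) (int-neg (+ i))))

  deriv-⊗ : ∀ x y → deriv (x ⊗ y) ≋ deriv x ⊗ y ⊕ x ⊗ deriv y
  deriv-⊗ x y = ≋-sym (≋-trans (⊕-sameDeg (deriv x ⊗ y) (x ⊗ deriv y) refl) (≋-intro refl leibniz))
    where
    α β : ℚ
    α = int (deg x)
    β = int (deg y)
    c-deriv-⊗ : c (deriv x ⊗ y) ≗ shift (euler α (c x) ⋆ c y)
    c-deriv-⊗ n = trans (c-⊗ (deriv x) y n)
      (trans (⋆-congˡ (c y) (c-deriv x) n) (⋆-shiftˡ (euler α (c x)) (c y) n))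
    c-⊗-deriv : c (x ⊗ deriv y) ≗ shift (euler β (c y) ⋆ c x)
    c-⊗-deriv n = trans (c-⊗ x (deriv y) n) (trans (⋆-comm (c x) (c (deriv y)) n)
      (trans (⋆-congˡ (c x) (c-deriv y) n) (⋆-shiftˡ (euler β (c y)) (c x) n)))
    leibniz : c (deriv x ⊗ y) +ₛ c (x ⊗ deriv y) ≗ c (deriv (x ⊗ y))
    leibniz zero    = trans (cong₂ ℚ._+_ (c-deriv-⊗ 0) (c-⊗-deriv 0)) (ℚP.+-identityˡ 0ℚ)
    leibniz (suc n) = trans (cong₂ ℚ._+_ (c-deriv-⊗ (suc n)) (c-⊗-deriv (suc n)))
      (trans (⋆-euler α β (c x) (c y) n)
      (sym (cong₂ ℚ._*_ (trans (int-+ (deg x ℤ.+ deg y) (ℤ.- + n))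
                               (cong₂ ℚ._+_ (int-+ (deg x) (deg y)) (int-neg (+ n))))
                        (c-⊗ x y n))))

ℤ-rawRing : RawRing _ _
ℤ-rawRing = CommutativeRing.rawRing ℤP.+-*-commutativeRing

-- Coefficients are taken in ℤ, whose equality is decidable, so that normal forms compute.
module ℤ-Solver {r₁ r₂} (R : AlmostCommutativeRing r₁ r₂) (morphism : ℤ-rawRing -Raw-AlmostCommutative⟶ R) where

  open AlmostCommutativeRing R using (reflexive)

  _≟_ : WeaklyDecidable (Induced-equivalence morphism)
  a ≟ b with a ℤP.≟ b
  ... | yes a≡b = just (reflexive (cong (_-Raw-AlmostCommutative⟶_.⟦_⟧ morphism) a≡b))
  ... | no  _   = nothing

  open Algebra.Solver.Ring ℤ-rawRing R morphism _≟_ public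
  open import Algebra.Properties.Semiring.Exp (AlmostCommutativeRing.semiring R) using (_^_)

  weaken : ∀ {m} k → Polynomial m → Polynomial (m ℕ.+ k)
  weaken k (op o e f) = op o (weaken k e) (weaken k f)
  weaken k (con z)    = con z
  weaken k (var i)    = var (i Fin.↑ˡ k)
  weaken k (e :^ n)   = weaken k e :^ n
  weaken k (:- e)     = :- weaken k e

  ⟦⟧-weaken : ∀ {m k} (e : Polynomial m) ρ (τ : Vec _ k) → ⟦ weaken k e ⟧ (ρ Vec.++ τ) ≡ ⟦ e ⟧ ρ
  ⟦⟧-weaken (op o e f) ρ τ = cong₂ (sem o) (⟦⟧-weaken e ρ τ) (⟦⟧-weaken f ρ τ)
  ⟦⟧-weaken (con z)    ρ τ = refl
  ⟦⟧-weaken (var i)    ρ τ = VecP.lookup-++ˡ ρ τ i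
  ⟦⟧-weaken (e :^ n)   ρ τ = cong (_^ n) (⟦⟧-weaken e ρ τ)
  ⟦⟧-weaken (:- e)     ρ τ = cong (AlmostCommutativeRing.-_ R) (⟦⟧-weaken e ρ τ)


module LaurentRing where

  open CauchyProduct
  open LaurentArithmetic
  open Derivation

  ⊕-⊗-isCommutativeRing : IsCommutativeRing _≋_ _⊕_ _⊗_ ⊖_ 0L 1L
  ⊕-⊗-isCommutativeRing = record
    { isRing = record
      { +-isAbelianGroup = record
        { isGroup = record
          { isMonoid = record
            { isSemigroup = record
              { isMagma = record { isEquivalence = ≋-isEquivalence ; ∙-cong = ⊕-cong }
              ; assoc = ⊕-assoc }
            ; identity = ⊕-identityˡ , ⊕-identityʳ }
          ; inverse = ⊕-inverseˡ , ⊕-inverseʳ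
          ; ⁻¹-cong = ⊖-cong }
        ; comm = ⊕-comm }
      ; *-cong = ⊗-cong
      ; *-assoc = ⊗-assoc
      ; *-identity = ⊗-identityˡ , ⊗-identityʳ
      ; distrib = (λ x y z → ⊗-distribˡ x y z) , (λ x y z → ⊗-distribʳ x y z) }
    ; *-comm = ⊗-comm }

  -- The ring below is built on opaque copies of the operations, so that Agda compares solver terms
  -- structurally instead of unfolding them into the series arithmetic, which is exponentially costly.
  infixl 6 _+ᴸ_
  infixl 7 _*ᴸ_
  infix  8 -ᴸ_

  opaque
    _+ᴸ_ _*ᴸ_ : Laurent → Laurent → Laurent
    _+ᴸ_ = _⊕_
    _*ᴸ_ = _⊗_

    -ᴸ_ : Laurent → Laurent
    -ᴸ_ = ⊖_

  opaque
    unfolding _+ᴸ_ _*ᴸ_ -ᴸ_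

    ⊕⇒+ᴸ : ∀ {x x′ y y′} → x ≋ x′ → y ≋ y′ → x ⊕ y ≋ x′ +ᴸ y′
    ⊕⇒+ᴸ = ⊕-cong

    ⊗⇒*ᴸ : ∀ {x x′ y y′} → x ≋ x′ → y ≋ y′ → x ⊗ y ≋ x′ *ᴸ y′
    ⊗⇒*ᴸ = ⊗-cong

    ⊖⇒-ᴸ : ∀ {x x′} → x ≋ x′ → ⊖ x ≋ -ᴸ x′
    ⊖⇒-ᴸ = ⊖-cong

    isCommutativeRing : IsCommutativeRing _≋_ _+ᴸ_ _*ᴸ_ -ᴸ_ 0L 1L
    isCommutativeRing = ⊕-⊗-isCommutativeRing

    sum-rule : ∀ {u u′ v v′} → deriv u ≋ u′ → deriv v ≋ v′ → deriv (u +ᴸ v) ≋ u′ +ᴸ v′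
    sum-rule {u} {v = v} du dv = ≋-trans (deriv-⊕ u v) (⊕-cong du dv)

    product-rule : ∀ {u u′} y → deriv u ≋ u′ → deriv (u *ᴸ y) ≋ u′ *ᴸ y +ᴸ u *ᴸ deriv y
    product-rule {u} y du = ≋-trans (deriv-⊗ u y) (⊕-cong (⊗-congˡ y du) ≋-refl)

  laurentRing : CommutativeRing _ _
  laurentRing = record { isCommutativeRing = isCommutativeRing }

  ⊗-zeroʳ : ∀ x → x ⊗ 0L ≋ 0L
  ⊗-zeroʳ x = ≋-trans (⊗⇒*ᴸ ≋-refl ≋-refl) (CommutativeRing.zeroʳ laurentRing x)

  ⊗-zeroˡ : ∀ x → 0L ⊗ x ≋ 0L
  ⊗-zeroˡ x = ≋-trans (⊗-comm 0L x) (⊗-zeroʳ x)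

  const : ℚ → Laurent
  const q = laurent (+ 0) (q ·ₛ δ)

  coeff-const⊗ : ∀ q y n → coeff (const q ⊗ y) n ≡ q ℚ.* coeff y n
  coeff-const⊗ q y n = begin
    coeff (const q ⊗ y) n                  ≡⟨ ≋⇒≈ (≋-intro {y = laurent (deg y) (q ·ₛ c y)}
                                                          (ℤP.+-identityˡ (deg y)) c-const⊗) n ⟩
    coeff (laurent (deg y) (q ·ₛ c y)) n   ≡⟨ coeff-atℤ (laurent (deg y) (q ·ₛ c y)) n ⟩
    atℤ (q ·ₛ c y) (deg y ℤ.- n)           ≡⟨ atℤ-map (q ℚ.*_) (ℚP.*-zeroʳ q) (λ _ → refl) (deg y ℤ.- n) ⟩
    q ℚ.* atℤ (c y) (deg y ℤ.- n)          ≡⟨ cong (q ℚ.*_) (coeff-atℤ y n) ⟨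
    q ℚ.* coeff y n                        ∎
    where
    open ≡-Reasoning
    c-const⊗ : c (const q ⊗ y) ≗ q ·ₛ c y
    c-const⊗ i = trans (c-⊗ (const q) y i) (trans (⋆-scaleˡ q δ (c y) i)
      (cong (q ℚ.*_) (trans (⋆-comm δ (c y) i) (⋆-identityʳ (c y) i))))

  coeff-const : ∀ q n → coeff (const q) n ≡ q ℚ.* coeff 1L n
  coeff-const q n = trans (≋⇒≈ (≋-sym (⊗-identityʳ (const q))) n) (coeff-const⊗ q 1L n)

  const-cong : ∀ {p q} → p ≡ q → const p ≋ const q
  const-cong refl = ≋-refl

  const-+ : ∀ p q → const (p ℚ.+ q) ≋ const p ⊕ const q
  const-+ p q = ≈⇒≋ λ n → trans (coeff-const (p ℚ.+ q) n) (trans (ℚP.*-distribʳ-+ (coeff 1L n) p q)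
    (sym (trans (coeff-⊕ (const p) (const q) n) (cong₂ ℚ._+_ (coeff-const p n) (coeff-const q n)))))

  const-* : ∀ p q → const (p ℚ.* q) ≋ const p ⊗ const q
  const-* p q = ≈⇒≋ λ n → trans (coeff-const (p ℚ.* q) n) (trans (ℚP.*-assoc p q (coeff 1L n))
    (sym (trans (coeff-const⊗ p (const q) n) (cong (p ℚ.*_) (coeff-const q n)))))

  const-neg : ∀ q → const (ℚ.- q) ≋ ⊖ const q
  const-neg q = ≈⇒≋ λ n → trans (coeff-const (ℚ.- q) n) (trans (sym (ℚP.neg-distribˡ-* q (coeff 1L n)))
    (sym (trans (coeff-⊖ (const q) n) (cong ℚ.-_ (coeff-const q n)))))

  const-0 : const 0ℚ ≋ 0L
  const-0 = ≈⇒≋ λ n → trans (coeff-const 0ℚ n) (trans (ℚP.*-zeroˡ (coeff 1L n)) (sym (coeff-0L n)))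

  const-1 : const 1ℚ ≋ 1L
  const-1 = ≈⇒≋ λ n → trans (coeff-const 1ℚ n) (ℚP.*-identityˡ (coeff 1L n))

  laurentACR : AlmostCommutativeRing _ _
  laurentACR = fromCommutativeRing laurentRing

  constℤ : ℤ-rawRing -Raw-AlmostCommutative⟶ laurentACR
  constℤ = record
    { ⟦_⟧    = const ∘ int
    ; +-homo = λ a b → ≋-trans (const-cong (int-+ a b)) (≋-trans (const-+ (int a) (int b)) (⊕⇒+ᴸ ≋-refl ≋-refl))
    ; *-homo = λ a b → ≋-trans (const-cong (int-* a b)) (≋-trans (const-* (int a) (int b)) (⊗⇒*ᴸ ≋-refl ≋-refl))
    ; -‿homo = λ a → ≋-trans (const-cong (int-neg a)) (≋-trans (const-neg (int a)) (⊖⇒-ᴸ ≋-refl))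
    ; 0-homo = const-0
    ; 1-homo = const-1
    }


module PolynomialEmbedding where

  open CauchyProduct
  open LaurentArithmetic
  open Derivation
  open LaurentRing
  open import Data.Integer.Solver using (module +-*-Solver)
  open +-*-Solver using (solve; _:=_; con; _:+_; _:-_)

  nth-beyond : ∀ p m → length p ℕ.≤ m → nth p m ≡ 0ℚ
  nth-beyond []      m       _            = refl
  nth-beyond (a ∷ p) (suc m) (ℕ.s≤s L≤m) = nth-beyond p m L≤m

  coeff-ι : ∀ p → coeff (ι p) ≗ atℤ (nth p)
  coeff-ι p n = trans (≋⇒≈ (≋-intro {y = laurent (+ L) (λ i → atℤ (nth p) (+ L ℤ.- + i))} refl generator) n)
                      (coeff-laurent (+ L) (atℤ (nth p)) vanishes n)
    where
    L : ℕ
    L = length p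
    generator : ∀ i → (if i ℕ.≤ᵇ L then nth p (L ∸ i) else 0ℚ) ≡ atℤ (nth p) (+ L ℤ.- + i)
    generator i with i ℕ.≤ᵇ L | ℕP.≤ᵇ-reflects-≤ i L
    ... | true  | ofʸ i≤L = cong (atℤ (nth p)) (sym (trans (ℤP.m-n≡m⊖n L i) (ℤP.⊖-≥ i≤L)))
    ... | false | ofⁿ i≰L = sym (atℤ-negative (nth p) (subst (ℤ._< 0ℤ) (sym (ℤP.m-n≡m⊖n L i))
                              (subst (L ℤ.⊖ i ℤ.<_) (ℤP.n⊖n≡0 L) (ℤP.⊖-monoʳ->-< L (ℕP.≰⇒> i≰L)))))
    vanishes : ∀ n → + L ℤ.- n ℤ.< 0ℤ → atℤ (nth p) n ≡ 0ℚ
    vanishes -[1+ _ ] _ = refl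
    vanishes (+ m) L-m<0 with m ℕ.≤? L
    ... | yes m≤L = ⊥-elim (ℤP.+≮0 (subst (ℤ._< 0ℤ) (trans (ℤP.m-n≡m⊖n L m) (ℤP.⊖-≥ m≤L)) L-m<0))
    ... | no  m≰L = nth-beyond p m (ℕP.<⇒≤ (ℕP.≰⇒> m≰L))

  ι≋-intro : ∀ p {X : Laurent} → (∀ n → atℤ (nth p) n ≡ coeff X n) → ι p ≋ X
  ι≋-intro p coeffs = ≈⇒≋ λ n → trans (coeff-ι p n) (coeffs n)

  nth-+ : ∀ p q m → nth (p +ₚ q) m ≡ nth p m ℚ.+ nth q m
  nth-+ []      q       m       = sym (ℚP.+-identityˡ _)
  nth-+ (a ∷ p) []      m       = sym (ℚP.+-identityʳ _)
  nth-+ (a ∷ p) (b ∷ q) zero    = refl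
  nth-+ (a ∷ p) (b ∷ q) (suc m) = nth-+ p q m

  nth-neg : ∀ p m → nth (-ₚ p) m ≡ ℚ.- nth p m
  nth-neg []      m       = refl
  nth-neg (a ∷ p) zero    = refl
  nth-neg (a ∷ p) (suc m) = nth-neg p m

  nth-· : ∀ s p m → nth (s ·ₚ p) m ≡ s ℚ.* nth p m
  nth-· s []      m       = sym (ℚP.*-zeroʳ s)
  nth-· s (a ∷ p) zero    = refl
  nth-· s (a ∷ p) (suc m) = nth-· s p m

  ι-+ : ∀ p q → ι (p +ₚ q) ≋ ι p ⊕ ι q
  ι-+ p q = ι≋-intro (p +ₚ q) λ n → begin
    atℤ (nth (p +ₚ q)) n                  ≡⟨ atℤ-cong (nth-+ p q) n ⟩
    atℤ (nth p +ₛ nth q) n                ≡⟨ atℤ-+ n ⟩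
    atℤ (nth p) n ℚ.+ atℤ (nth q) n       ≡⟨ cong₂ ℚ._+_ (coeff-ι p n) (coeff-ι q n) ⟨
    coeff (ι p) n ℚ.+ coeff (ι q) n       ≡⟨ coeff-⊕ (ι p) (ι q) n ⟨
    coeff (ι p ⊕ ι q) n                   ∎
    where
    open ≡-Reasoning
    atℤ-+ : ∀ j → atℤ (nth p +ₛ nth q) j ≡ atℤ (nth p) j ℚ.+ atℤ (nth q) j
    atℤ-+ (+ _)    = refl
    atℤ-+ -[1+ _ ] = sym (ℚP.+-identityˡ 0ℚ)

  ι-neg : ∀ p → ι (-ₚ p) ≋ ⊖ ι p
  ι-neg p = ι≋-intro (-ₚ p) λ n → trans (atℤ-map ℚ.-_ refl (nth-neg p) n)
    (sym (trans (coeff-⊖ (ι p) n) (cong ℚ.-_ (coeff-ι p n))))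

  ι-· : ∀ s p → ι (s ·ₚ p) ≋ const s ⊗ ι p
  ι-· s p = ι≋-intro (s ·ₚ p) λ n → trans (atℤ-map (s ℚ.*_) (ℚP.*-zeroʳ s) (nth-· s p) n)
    (sym (trans (coeff-const⊗ s (ι p) n) (cong (s ℚ.*_) (coeff-ι p n))))

  ι-[] : ι [] ≋ 0L
  ι-[] = ι≋-intro [] λ n → trans (atℤ-zero n) (sym (coeff-0L n))

  t : Laurent
  t = laurent (+ 1) δ

  coeff-t⊗ : ∀ y n → coeff (t ⊗ y) n ≡ coeff y (n ℤ.- + 1)
  coeff-t⊗ y n = begin
    coeff (t ⊗ y) n                        ≡⟨ ≋⇒≈ (≋-intro {y = laurent (+ 1 ℤ.+ deg y) (c y)} refl c-t⊗) n ⟩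
    coeff (laurent (+ 1 ℤ.+ deg y) (c y)) n ≡⟨ coeff-atℤ (laurent (+ 1 ℤ.+ deg y) (c y)) n ⟩
    atℤ (c y) ((+ 1 ℤ.+ deg y) ℤ.- n)      ≡⟨ cong (atℤ (c y))
                                                (solve 2 (λ d n → (con (+ 1) :+ d) :- n := d :- (n :- con (+ 1))) refl (deg y) n) ⟩
    atℤ (c y) (deg y ℤ.- (n ℤ.- + 1))      ≡⟨ coeff-atℤ y (n ℤ.- + 1) ⟨
    coeff y (n ℤ.- + 1)                    ∎
    where
    open ≡-Reasoning
    c-t⊗ : c (t ⊗ y) ≗ c y
    c-t⊗ i = trans (c-⊗ t y i) (trans (⋆-comm δ (c y) i) (⋆-identityʳ (c y) i))

  ι-∷ : ∀ a p → ι (a ∷ p) ≋ const a ⊕ t ⊗ ι p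
  ι-∷ a p = ι≋-intro (a ∷ p) λ n → trans (nth-∷ n) (sym (trans (coeff-⊕ (const a) (t ⊗ ι p) n)
    (cong₂ ℚ._+_ (coeff-const a n) (trans (coeff-t⊗ (ι p) n) (coeff-ι p (n ℤ.- + 1))))))
    where
    nth-∷ : ∀ n → atℤ (nth (a ∷ p)) n ≡ a ℚ.* coeff 1L n ℚ.+ atℤ (nth p) (n ℤ.- + 1)
    nth-∷ (+ zero)  = sym (trans (cong (ℚ._+ 0ℚ) (ℚP.*-identityʳ a)) (ℚP.+-identityʳ a))
    nth-∷ (+ suc m) = sym (trans (cong (ℚ._+ nth p m) (ℚP.*-zeroʳ a)) (ℚP.+-identityˡ _))
    nth-∷ -[1+ _ ]  = sym (trans (cong (ℚ._+ 0ℚ) (ℚP.*-zeroʳ a)) (ℚP.+-identityˡ _))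

  ι-singleton : ∀ a → ι (a ∷ []) ≋ const a
  ι-singleton a = begin
    ι (a ∷ [])                ≈⟨ ι-∷ a [] ⟩
    const a ⊕ t ⊗ ι []        ≈⟨ ⊕-cong (≋-refl {const a}) (⊗-congʳ t ι-[]) ⟩
    const a ⊕ t ⊗ 0L          ≈⟨ ⊕-cong (≋-refl {const a}) (⊗-zeroʳ t) ⟩
    const a ⊕ 0L              ≈⟨ ⊕-identityʳ (const a) ⟩
    const a                   ∎
    where open SetoidReasoning ≋-setoid

  ι-* : ∀ p q → ι (p *ₚ q) ≋ ι p ⊗ ι q
  ι-* []      q = ≋-trans ι-[] (≋-sym (≋-trans (⊗-congˡ (ι q) ι-[]) (⊗-zeroˡ (ι q))))
  ι-* (a ∷ p) q = begin
    ι ((a ·ₚ q) +ₚ (0ℚ ∷ (p *ₚ q)))               ≈⟨ ι-+ (a ·ₚ q) (0ℚ ∷ (p *ₚ q)) ⟩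
    ι (a ·ₚ q) ⊕ ι (0ℚ ∷ (p *ₚ q))                ≈⟨ ⊕-cong (ι-· a q) (ι-∷ 0ℚ (p *ₚ q)) ⟩
    const a ⊗ ι q ⊕ (const 0ℚ ⊕ t ⊗ ι (p *ₚ q))   ≈⟨ ⊕-cong (≋-refl {const a ⊗ ι q}) (⊕-cong const-0 (≋-refl {t ⊗ ι (p *ₚ q)})) ⟩
    const a ⊗ ι q ⊕ (0L ⊕ t ⊗ ι (p *ₚ q))         ≈⟨ ⊕-cong (≋-refl {const a ⊗ ι q}) (⊕-identityˡ (t ⊗ ι (p *ₚ q))) ⟩
    const a ⊗ ι q ⊕ t ⊗ ι (p *ₚ q)                ≈⟨ ⊕-cong (≋-refl {const a ⊗ ι q}) (⊗-congʳ t (ι-* p q)) ⟩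
    const a ⊗ ι q ⊕ t ⊗ (ι p ⊗ ι q)               ≈⟨ ⊕-cong (≋-refl {const a ⊗ ι q}) (⊗-assoc t (ι p) (ι q)) ⟨
    const a ⊗ ι q ⊕ t ⊗ ι p ⊗ ι q                 ≈⟨ ⊗-distribʳ (ι q) (const a) (t ⊗ ι p) ⟨
    (const a ⊕ t ⊗ ι p) ⊗ ι q                     ≈⟨ ⊗-congˡ (ι q) (ι-∷ a p) ⟨
    ι (a ∷ p) ⊗ ι q                               ∎
    where open SetoidReasoning ≋-setoid

  nth-derivFrom : ∀ i p m → nth (derivFrom i p) m ≡ int (+ (i ℕ.+ m)) ℚ.* nth p m
  nth-derivFrom i []      m       = sym (ℚP.*-zeroʳ (int (+ (i ℕ.+ m))))
  nth-derivFrom i (a ∷ p) zero    = cong (λ j → int (+ j) ℚ.* a) (sym (ℕP.+-identityʳ i))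
  nth-derivFrom i (a ∷ p) (suc m) =
    trans (nth-derivFrom (suc i) p m) (cong (λ j → int (+ j) ℚ.* nth p m) (sym (ℕP.+-suc i m)))

  ι-derivₚ : ∀ p → ι (derivₚ p) ≋ deriv (ι p)
  ι-derivₚ p = ι≋-intro (derivₚ p) λ n → trans (nth-derivₚ p n)
    (sym (trans (coeff-deriv (ι p) n) (cong (int (n ℤ.+ + 1) ℚ.*_) (coeff-ι p (n ℤ.+ + 1)))))
    where
    nth-derivₚ : ∀ p n → atℤ (nth (derivₚ p)) n ≡ int (n ℤ.+ + 1) ℚ.* atℤ (nth p) (n ℤ.+ + 1)
    nth-derivₚ []      n              =
      trans (atℤ-zero n) (sym (trans (cong (int (n ℤ.+ + 1) ℚ.*_) (atℤ-zero (n ℤ.+ + 1))) (ℚP.*-zeroʳ (int (n ℤ.+ + 1)))))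
    nth-derivₚ (a ∷ p) (+ m)          =
      trans (nth-derivFrom 1 p m) (cong (λ j → int (+ j) ℚ.* nth (a ∷ p) j) (ℕP.+-comm 1 m))
    nth-derivₚ (a ∷ p) -[1+ zero ]    = sym (ℚP.*-zeroˡ a)
    nth-derivₚ (a ∷ p) -[1+ suc m ]   = sym (ℚP.*-zeroʳ (int (-[1+ suc m ] ℤ.+ + 1)))

-- The identities hold in every commutative ring; proving them abstractly lets Agda compare the
-- normalised sides without unfolding the arithmetic of a concrete ring.
module Certificate {r₁ r₂} (R : AlmostCommutativeRing r₁ r₂) (morphism : ℤ-rawRing -Raw-AlmostCommutative⟶ R) where

  open AlmostCommutativeRing R using () renaming (_≈_ to _≈ᴿ_; refl to ≈ᴿ-refl)
  open ℤ-Solver R morphism public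
    using (Polynomial; op; [+]; [*]; con; var; _:^_; :-_; _:+_; _:*_; _:-_; ⟦_⟧; ⟦⟧-weaken)
  open ℤ-Solver R morphism using (prove; weaken)

  det3ᶠ : ∀ {n} → (a b c d e f g h i : Polynomial n) → Polynomial n
  det3ᶠ a b c d e f g h i =
    ((a :* ((e :* i) :- (f :* h))) :- (b :* ((d :* i) :- (f :* g)))) :+ (c :* ((d :* h) :- (e :* g)))

  κ : ∀ {n} → ℕ → Polynomial n
  κ m = con (+ m)

  -- D, b₃A, b₃B and C transcribe the determinants of Defs entry by entry; A = b₃A / b₃ and B = b₃B / b₃.
  module CoefficientFormulas {n} (b₀ b₁ b₂ b₃ b₀′ b₁′ b₂′ b₃′ : Polynomial n) where

    w : Polynomial n → Polynomial n → Polynomial n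
    w bᵢ bᵢ′ = (bᵢ :* b₃′) :- (b₃ :* bᵢ′)

    w₀ w₁ w₂ : Polynomial n
    w₀ = w b₀ b₀′
    w₁ = w b₁ b₁′
    w₂ = w b₂ b₂′

    e₀ e₁ e₂ : Polynomial n
    e₀ = b₂ :* b₀
    e₁ = (b₂ :* b₁) :- (con (+ 3) :* (b₃ :* b₀))
    e₂ = (b₂ :* b₂) :- (con (+ 2) :* (b₃ :* b₁))

    D b₃A b₃B C : Polynomial n
    D   = det3ᶠ b₁                 (con (ℤ.- + 3) :* b₀) e₀
                (con (+ 2) :* b₂)  (con (ℤ.- + 2) :* b₁) e₁
                (con (+ 3) :* b₃)  (:- b₂)               e₂
    b₃A = det3ᶠ w₀                 (con (ℤ.- + 3) :* b₀) e₀
                w₁                 (con (ℤ.- + 2) :* b₁) e₁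
                w₂                 (:- b₂)               e₂
    b₃B = det3ᶠ b₁                 w₀                    e₀
                (con (+ 2) :* b₂)  w₁                    e₁
                (con (+ 3) :* b₃)  w₂                    e₂
    C   = det3ᶠ b₁                 (con (ℤ.- + 3) :* b₀) w₀
                (con (+ 2) :* b₂)  (con (ℤ.- + 2) :* b₁) w₁
                (con (+ 3) :* b₃)  (:- b₂)               w₂

    A B : Polynomial n
    A = b₁ :* b₂ :* b₂ :* b₀′
      :- κ 4 :* b₁ :* b₁ :* b₃ :* b₀′
      :+ κ 3 :* b₀ :* b₂ :* b₃ :* b₀′
      :- κ 2 :* b₀ :* b₂ :* b₂ :* b₁′
      :+ κ 6 :* b₀ :* b₁ :* b₃ :* b₁′
      :+ b₀ :* b₁ :* b₂ :* b₂′
      :- κ 2 :* b₀ :* b₁ :* b₁ :* b₃′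
      :- κ 9 :* b₀ :* b₀ :* b₃ :* b₂′
      :+ κ 6 :* b₀ :* b₀ :* b₂ :* b₃′
    B = κ 2 :* b₂ :* b₂ :* b₂ :* b₀′
      :- κ 7 :* b₁ :* b₂ :* b₃ :* b₀′
      :- b₁ :* b₂ :* b₂ :* b₁′
      :+ κ 2 :* b₁ :* b₁ :* b₃ :* b₁′
      :+ b₁ :* b₁ :* b₂ :* b₂′
      :- κ 2 :* b₁ :* b₁ :* b₁ :* b₃′
      :+ κ 9 :* b₀ :* b₃ :* b₃ :* b₀′
      :+ κ 3 :* b₀ :* b₂ :* b₃ :* b₁′
      :- κ 2 :* b₀ :* b₂ :* b₂ :* b₂′
      :- κ 3 :* b₀ :* b₁ :* b₃ :* b₂′
      :+ κ 7 :* b₀ :* b₁ :* b₂ :* b₃′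
      :- κ 9 :* b₀ :* b₀ :* b₃ :* b₃′

  module CubicFormulas {n} (b₀ b₁ b₂ b₃ b₀′ b₁′ b₂′ b₃′ : Polynomial n) where

    P : Polynomial n → Polynomial n
    P x = b₃ :* x :* x :* x :+ b₂ :* x :* x :+ b₁ :* x :+ b₀

    -- The derivative of P(x) as the sum and product rules expand it.
    P′ : Polynomial n → Polynomial n → Polynomial n
    P′ x x′ = leibniz (b₃ :* x :* x) (leibniz (b₃ :* x) (leibniz b₃ b₃′))
            :+ leibniz (b₂ :* x) (leibniz b₂ b₂′) :+ leibniz b₁ b₁′ :+ b₀′
      where
      leibniz : Polynomial n → Polynomial n → Polynomial n
      leibniz u u′ = u′ :* x :+ u :* x′

    -- Found by computer algebra; riccati-identity below is the check.
    U : Polynomial n → Polynomial n → Polynomial n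
    U x x′ = κ 2 :* b₂ :* b₂ :* b₃′ :* x :* x
           :+ κ 2 :* b₂ :* b₂ :* b₂′ :* x
           :+ κ 2 :* b₂ :* b₂ :* b₁′
           :+ κ 6 :* b₂ :* b₂ :* b₃ :* x :* x′
           :+ κ 4 :* b₂ :* b₂ :* b₂ :* x′
           :- κ 6 :* b₁ :* b₃ :* b₃′ :* x :* x
           :- κ 6 :* b₁ :* b₃ :* b₂′ :* x
           :- κ 6 :* b₁ :* b₃ :* b₁′
           :- κ 18 :* b₁ :* b₃ :* b₃ :* x :* x′
           :- b₁ :* b₂ :* b₃′ :* x
           :- b₁ :* b₂ :* b₂′
           :- κ 15 :* b₁ :* b₂ :* b₃ :* x′
           :+ κ 2 :* b₁ :* b₁ :* b₃′
           :+ κ 9 :* b₀ :* b₃ :* b₃′ :* x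
           :+ κ 9 :* b₀ :* b₃ :* b₂′
           :+ κ 27 :* b₀ :* b₃ :* b₃ :* x′
           :- κ 6 :* b₀ :* b₂ :* b₃′

    V : Polynomial n → Polynomial n
    V x    = κ 6 :* b₁ :* b₃ :* b₃ :* x :* x
           :- κ 2 :* b₂ :* b₂ :* b₃ :* x :* x
           :- κ 2 :* b₂ :* b₂ :* b₂ :* x
           :+ κ 7 :* b₁ :* b₂ :* b₃ :* x
           :- b₁ :* b₂ :* b₂
           :+ κ 4 :* b₁ :* b₁ :* b₃
           :- κ 9 :* b₀ :* b₃ :* b₃ :* x
           :- κ 3 :* b₀ :* b₂ :* b₃

  b₀ b₁ b₂ b₃ b₀′ b₁′ b₂′ b₃′ : Polynomial 8
  b₀  = var (# 0)
  b₁  = var (# 1)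
  b₂  = var (# 2)
  b₃  = var (# 3)
  b₀′ = var (# 4)
  b₁′ = var (# 5)
  b₂′ = var (# 6)
  b₃′ = var (# 7)

  open CoefficientFormulas b₀ b₁ b₂ b₃ b₀′ b₁′ b₂′ b₃′ public

  b₃A-identity : ∀ ρ → ⟦ b₃ :* A ⟧ ρ ≈ᴿ ⟦ b₃A ⟧ ρ
  b₃A-identity ρ = prove ρ (b₃ :* A) b₃A ≈ᴿ-refl

  b₃B-identity : ∀ ρ → ⟦ b₃ :* B ⟧ ρ ≈ᴿ ⟦ b₃B ⟧ ρ
  b₃B-identity ρ = prove ρ (b₃ :* B) b₃B ≈ᴿ-refl

  ↑ : Polynomial 8 → Polynomial 10
  ↑ = weaken 2

  x x′ : Polynomial 10
  x  = var (# 8)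
  x′ = var (# 9)

  open CubicFormulas (↑ b₀) (↑ b₁) (↑ b₂) (↑ b₃) (↑ b₀′) (↑ b₁′) (↑ b₂′) (↑ b₃′) public

  riccati-identity : ∀ ρ → ⟦ ↑ D :* x′ ⟧ ρ
                         ≈ᴿ ⟦ ↑ A :+ ↑ B :* x :+ ↑ C :* x :* x :+ U x x′ :* P x :+ V x :* P′ x x′ ⟧ ρ
  riccati-identity ρ =
    prove ρ (↑ D :* x′) (↑ A :+ ↑ B :* x :+ ↑ C :* x :* x :+ U x x′ :* P x :+ V x :* P′ x x′) ≈ᴿ-refl

module LaurentCertificate = Certificate LaurentRing.laurentACR LaurentRing.constℤ

module Realisation {m} (ρₚ : Vec Poly m) where

  open LaurentArithmetic
  open LaurentRing
  open PolynomialEmbedding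
  open LaurentCertificate using (Polynomial; op; [+]; [*]; con; var; _:^_; :-_; _:+_; _:*_; _:-_; ⟦_⟧; det3ᶠ)

  ρ : Vec Laurent m
  ρ = Vec.map ι ρₚ

  record Realised (e : Polynomial m) : Set where
    field
      poly   : Poly
      ι-poly : ι poly ≋ ⟦ e ⟧ ρ
  open Realised public

  infixl 7 _:+ʳ_ _:-ʳ_
  infixl 8 _:*ʳ_

  _:+ʳ_ : ∀ {e f} → Realised e → Realised f → Realised (e :+ f)
  r :+ʳ s = record
    { poly   = poly r +ₚ poly s
    ; ι-poly = ≋-trans (ι-+ (poly r) (poly s)) (⊕⇒+ᴸ (ι-poly r) (ι-poly s))
    }

  _:*ʳ_ : ∀ {e f} → Realised e → Realised f → Realised (e :* f)
  r :*ʳ s = record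
    { poly   = poly r *ₚ poly s
    ; ι-poly = ≋-trans (ι-* (poly r) (poly s)) (⊗⇒*ᴸ (ι-poly r) (ι-poly s))
    }

  :-ʳ_ : ∀ {e} → Realised e → Realised (:- e)
  :-ʳ r = record { poly = -ₚ poly r ; ι-poly = ≋-trans (ι-neg (poly r)) (⊖⇒-ᴸ (ι-poly r)) }

  _:-ʳ_ : ∀ {e f} → Realised e → Realised f → Realised (e :- f)
  r :-ʳ s = r :+ʳ (:-ʳ s)

  scaleʳ : ∀ z {e} → Realised e → Realised (con z :* e)
  scaleʳ z r = record
    { poly   = k z (poly r)
    ; ι-poly = ≋-trans (ι-· (int z) (poly r)) (⊗⇒*ᴸ ≋-refl (ι-poly r))
    }

  conʳ : ∀ z → Realised (con z)
  conʳ z = record { poly = int z ∷ [] ; ι-poly = ι-singleton (int z) }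

  varʳ : ∀ i → Realised (var i)
  varʳ i = record { poly = Vec.lookup ρₚ i ; ι-poly = ≋-reflexive (sym (VecP.lookup-map i ι ρₚ)) }

  _:^ʳ_ : ∀ {e} → Realised e → ∀ n → Realised (e :^ n)
  r :^ʳ zero  = record { poly = 1ℚ ∷ [] ; ι-poly = ≋-trans (ι-singleton 1ℚ) const-1 }
  r :^ʳ suc n = record { poly = poly r *ₚ poly (r :^ʳ n) ; ι-poly = ι-poly (r :*ʳ (r :^ʳ n)) }

  realise : ∀ e → Realised e
  realise (op [+] e f) = realise e :+ʳ realise f
  realise (op [*] e f) = realise e :*ʳ realise f
  realise (con z)      = conʳ z
  realise (var i)      = varʳ i
  realise (e :^ n)     = realise e :^ʳ n
  realise (:- e)       = :-ʳ realise e

  det3ʳ : ∀ {a b c d e f g h i} →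
          Realised a → Realised b → Realised c → Realised d → Realised e → Realised f →
          Realised g → Realised h → Realised i → Realised (det3ᶠ a b c d e f g h i)
  det3ʳ a b c d e f g h i =
    ((a :*ʳ ((e :*ʳ i) :-ʳ (f :*ʳ h))) :-ʳ (b :*ʳ ((d :*ʳ i) :-ʳ (f :*ʳ g)))) :+ʳ (c :*ʳ ((d :*ʳ h) :-ʳ (e :*ʳ g)))

module Riccati (b0 b1 b2 b3 : Poly) (x : Laurent) where

  open LaurentArithmetic
  open Derivation
  open LaurentRing
  open PolynomialEmbedding
  module Φ = LaurentCertificate
  open Φ hiding (x; x′)

  coefficients : Vec Poly 8
  coefficients = b0 ∷ b1 ∷ b2 ∷ b3 ∷ derivₚ b0 ∷ derivₚ b1 ∷ derivₚ b2 ∷ derivₚ b3 ∷ []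

  open Realisation coefficients

  wʳ : ∀ {bᵢ bᵢ′} → Realised bᵢ → Realised bᵢ′ → Realised (w bᵢ bᵢ′)
  wʳ r r′ = (r :*ʳ varʳ (# 7)) :-ʳ (varʳ (# 3) :*ʳ r′)

  w₀ʳ : Realised w₀
  w₀ʳ = wʳ (varʳ (# 0)) (varʳ (# 4))

  w₁ʳ : Realised w₁
  w₁ʳ = wʳ (varʳ (# 1)) (varʳ (# 5))

  w₂ʳ : Realised w₂
  w₂ʳ = wʳ (varʳ (# 2)) (varʳ (# 6))

  e₀ʳ : Realised e₀
  e₀ʳ = varʳ (# 2) :*ʳ varʳ (# 0)

  e₁ʳ : Realised e₁
  e₁ʳ = (varʳ (# 2) :*ʳ varʳ (# 1)) :-ʳ scaleʳ (+ 3) (varʳ (# 3) :*ʳ varʳ (# 0))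

  e₂ʳ : Realised e₂
  e₂ʳ = (varʳ (# 2) :*ʳ varʳ (# 2)) :-ʳ scaleʳ (+ 2) (varʳ (# 3) :*ʳ varʳ (# 1))

  -- These follow Defs term by term, so that their polynomials are Dₚ, b3Aₚ, b3Bₚ and Cₚ on the nose.
  Dʳ : Realised D
  Dʳ = det3ʳ (varʳ (# 1))                (scaleʳ (ℤ.- + 3) (varʳ (# 0))) e₀ʳ
             (scaleʳ (+ 2) (varʳ (# 2))) (scaleʳ (ℤ.- + 2) (varʳ (# 1))) e₁ʳ
             (scaleʳ (+ 3) (varʳ (# 3))) (:-ʳ varʳ (# 2))                e₂ʳ

  b₃Aʳ : Realised b₃A
  b₃Aʳ = det3ʳ w₀ʳ (scaleʳ (ℤ.- + 3) (varʳ (# 0))) e₀ʳ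
               w₁ʳ (scaleʳ (ℤ.- + 2) (varʳ (# 1))) e₁ʳ
               w₂ʳ (:-ʳ varʳ (# 2))                e₂ʳ

  b₃Bʳ : Realised b₃B
  b₃Bʳ = det3ʳ (varʳ (# 1))                w₀ʳ e₀ʳ
               (scaleʳ (+ 2) (varʳ (# 2))) w₁ʳ e₁ʳ
               (scaleʳ (+ 3) (varʳ (# 3))) w₂ʳ e₂ʳ

  Cʳ : Realised C
  Cʳ = det3ʳ (varʳ (# 1))                (scaleʳ (ℤ.- + 3) (varʳ (# 0))) w₀ʳ
             (scaleʳ (+ 2) (varʳ (# 2))) (scaleʳ (ℤ.- + 2) (varʳ (# 1))) w₁ʳ
             (scaleʳ (+ 3) (varʳ (# 3))) (:-ʳ varʳ (# 2))                w₂ʳ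

  Aₚ Bₚ : Poly
  Aₚ = poly (realise A)
  Bₚ = poly (realise B)

  b₃A-correct : ι (b3 *ₚ Aₚ) ≋ ι (b3Aₚ b0 b1 b2 b3)
  b₃A-correct = ≋-trans (ι-poly (realise (b₃ :* A))) (≋-trans (b₃A-identity ρ) (≋-sym (ι-poly b₃Aʳ)))

  b₃B-correct : ι (b3 *ₚ Bₚ) ≋ ι (b3Bₚ b0 b1 b2 b3)
  b₃B-correct = ≋-trans (ι-poly (realise (b₃ :* B))) (≋-trans (b₃B-identity ρ) (≋-sym (ι-poly b₃Bʳ)))

  σ : Vec Laurent 10
  σ = ρ Vec.++ (x ∷ deriv x ∷ [])

  ι-poly↑ : ∀ {e} (r : Realised e) → ι (poly r) ≋ ⟦ ↑ e ⟧ σ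
  ι-poly↑ {e} r = ≋-trans (ι-poly r) (≋-reflexive (sym (⟦⟧-weaken e ρ (x ∷ deriv x ∷ []))))

  cubic : Laurent
  cubic = ⟦ P Φ.x ⟧ σ

  cubic≋ : cubic ≋ ι b3 ⊗ x ⊗ x ⊗ x ⊕ ι b2 ⊗ x ⊗ x ⊕ ι b1 ⊗ x ⊕ ι b0
  cubic≋ = ≋-sym (⊕⇒+ᴸ (⊕⇒+ᴸ (⊕⇒+ᴸ (⊗⇒*ᴸ (⊗⇒*ᴸ (⊗⇒*ᴸ r r) r) r) (⊗⇒*ᴸ (⊗⇒*ᴸ r r) r)) (⊗⇒*ᴸ r r)) r)
    where
    r : ∀ {y} → y ≋ y
    r = ≋-refl

  deriv-cubic : deriv cubic ≋ ⟦ P′ Φ.x Φ.x′ ⟧ σ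
  deriv-cubic =
    sum-rule (sum-rule (sum-rule (product-rule x (product-rule x (product-rule x (deriv-ι b3))))
                                 (product-rule x (product-rule x (deriv-ι b2))))
                       (product-rule x (deriv-ι b1)))
             (deriv-ι b0)
    where
    deriv-ι : ∀ p → deriv (ι p) ≋ ι (derivₚ p)
    deriv-ι p = ≋-sym (ι-derivₚ p)

  riccati : ι b3 ⊗ x ⊗ x ⊗ x ⊕ ι b2 ⊗ x ⊗ x ⊕ ι b1 ⊗ x ⊕ ι b0 ≋ 0L →
            ι (Dₚ b0 b1 b2 b3) ⊗ deriv x ≋ ι Aₚ ⊕ ι Bₚ ⊗ x ⊕ ι (Cₚ b0 b1 b2 b3) ⊗ x ⊗ x
  riccati P[x]≋0 = begin
    ι (Dₚ b0 b1 b2 b3) ⊗ deriv x               ≈⟨ ⊗⇒*ᴸ (ι-poly↑ Dʳ) ≋-refl ⟩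
    ⟦ ↑ D :* Φ.x′ ⟧ σ                           ≈⟨ riccati-identity σ ⟩
    q +ᴸ u *ᴸ cubic +ᴸ v *ᴸ ⟦ P′ Φ.x Φ.x′ ⟧ σ   ≈⟨ +-cong (+-cong (≋-refl {q}) (*-cong (≋-refl {u}) cubic≋0))
                                                          (*-cong (≋-refl {v}) P′≋0) ⟩
    q +ᴸ u *ᴸ 0L +ᴸ v *ᴸ 0L                    ≈⟨ +-cong (+-cong (≋-refl {q}) (zeroʳ u)) (zeroʳ v) ⟩
    q +ᴸ 0L +ᴸ 0L                              ≈⟨ ≋-trans (+-identityʳ (q +ᴸ 0L)) (+-identityʳ q) ⟩
    q                                           ≈⟨ ⊕⇒+ᴸ (⊕⇒+ᴸ (ι-poly↑ (realise A)) (⊗⇒*ᴸ (ι-poly↑ (realise B)) ≋-refl))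
                                                        (⊗⇒*ᴸ (⊗⇒*ᴸ (ι-poly↑ Cʳ) ≋-refl) ≋-refl) ⟨
    ι Aₚ ⊕ ι Bₚ ⊗ x ⊕ ι (Cₚ b0 b1 b2 b3) ⊗ x ⊗ x  ∎
    where
    open SetoidReasoning ≋-setoid
    open CommutativeRing laurentRing using (+-cong; *-cong; zeroʳ; +-identityʳ)
    q u v : Laurent
    q = ⟦ ↑ A :+ ↑ B :* Φ.x :+ ↑ C :* Φ.x :* Φ.x ⟧ σ
    u = ⟦ U Φ.x Φ.x′ ⟧ σ
    v = ⟦ V Φ.x ⟧ σ
    cubic≋0 : cubic ≋ 0L
    cubic≋0 = ≋-trans cubic≋ P[x]≋0
    P′≋0 : ⟦ P′ Φ.x Φ.x′ ⟧ σ ≋ 0L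
    P′≋0 = ≋-trans (≋-sym deriv-cubic) (≋-trans (deriv-cong cubic≋0) deriv-0L)

proposition1 : (b0 b1 b2 b3 : Poly) → ¬ (ι b3 ≈ 0L) → (x : Laurent)
    → ((((ι b3 ⊗ x) ⊗ x) ⊗ x) ⊕ ((ι b2 ⊗ x) ⊗ x) ⊕ (ι b1 ⊗ x) ⊕ ι b0) ≈ 0L
    → Σ Poly λ A → Σ Poly λ B
        → (ι (b3 *ₚ A) ≈ ι (b3Aₚ b0 b1 b2 b3))
        × (ι (b3 *ₚ B) ≈ ι (b3Bₚ b0 b1 b2 b3))
        × ((ι (Dₚ b0 b1 b2 b3) ⊗ deriv x)
            ≈ (ι A ⊕ (ι B ⊗ x) ⊕ ((ι (Cₚ b0 b1 b2 b3) ⊗ x) ⊗ x)))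
proposition1 b0 b1 b2 b3 _ x cubic≈0 =
  Aₚ , Bₚ , ≋⇒≈ b₃A-correct , ≋⇒≈ b₃B-correct , ≋⇒≈ (riccati (≈⇒≋ cubic≈0))
  where
  open Riccati b0 b1 b2 b3 x
  open LaurentArithmetic using (≋⇒≈; ≈⇒≋)
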